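{- Let $p$ be a prime. For every integer $n\ge1$, $$\int_{\mathbb{Z}_p}x^{(n)}\,d\mu_1(x)=\sum_{k=1}^{n}(-1)^k\frac{n!}{k+1}\binom{n-1}{k-1}.$$
   Context: The Volkenborn integral of a polynomial function $f:\mathbb{Z}_p\to\mathbb{Q}_p$ is $\int_{\mathbb{Z}_p}f(x)\,d\mu_1(x)=\lim_{N\to\infty}p^{ -N}\sum_{x=0}^{p^N-1}f(x)$. The rising factorial is $x^{(n)}=x(x+1)\cdots(x+n-1)$, $x^{(0)}=1$. -}

module Defs where

open import Data.Nat as ℕ using (ℕ; zero; suc; _≤_; NonZero)
open import Data.Nat.Properties using (m^n≢0)
open import Data.Nat.Divisibility using (_∣_)
open import Data.Nat.Primality using (Prime; prime⇒nonZero)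
open import Data.Nat.Combinatorics using (_C_)
open import Data.Integer as ℤ using (ℤ; +_)
open import Data.Rational as ℚ using (ℚ; _/_)
open import Data.Product using (Σ; ∃; _×_)
open import Relation.Nullary using (¬_)
open import Relation.Binary.PropositionalEquality using (_≡_)

rising : ℕ → ℕ → ℕ
rising x zero    = 1
rising x (suc n) = rising x n ℕ.* (x ℕ.+ n)

sumBelow : ℕ → (ℕ → ℚ) → ℚ
sumBelow zero    f = ℚ.0ℚ
sumBelow (suc m) f = sumBelow m f ℚ.+ f m

ℤtoℚ : ℤ → ℚ
ℤtoℚ z = z / 1

-- v_p(q) ≥ k, i.e. q = p^k * a / b with a ∈ ℤ, b ∈ ℕ, p ∤ b
-- (this is |q|_p ≤ p^{-k}; q = 0 satisfies it for all k)
pAdicValAtLeast : ℕ → ℕ → ℚ → Set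
pAdicValAtLeast p k q =
  Σ ℤ λ a → Σ ℕ λ b → (¬ (p ∣ b)) ×
    (q ℚ.* ℤtoℚ (+ b) ≡ ℤtoℚ (+ (p ℕ.^ k) ℤ.* a))

PAdicConvergesTo : ℕ → (ℕ → ℚ) → ℚ → Set
PAdicConvergesTo p a L =
  (k : ℕ) → ∃ λ N₀ → (N : ℕ) → N₀ ≤ N → pAdicValAtLeast p k (a N ℚ.- L)

volkenbornSum : (p : ℕ) → Prime p → (ℕ → ℚ) → ℕ → ℚ
volkenbornSum p pr f N =
  let instance _ = prime⇒nonZero pr
               _ = m^n≢0 p N
  in (+ 1 / (p ℕ.^ N)) ℚ.* sumBelow (p ℕ.^ N) f

VolkenbornIntegralIs : (p : ℕ) → Prime p → (ℕ → ℚ) → ℚ → Set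
VolkenbornIntegralIs p pr f L = PAdicConvergesTo p (volkenbornSum p pr f) L

rhs : ℕ → ℚ
rhs n = sumBelow n λ j →
  let k = suc j in
  (ℤ.- (+ 1)) ℤ.^ k ℤ.* (+ ((n ℕ.!) ℕ.* ((n ℕ.∸ 1) C (k ℕ.∸ 1))))  / suc k

{-# OPTIONS --safe #-}
-- For n ≥ 1 the sums of the rising factorial telescope: (n+1) Σ_{x<M} x^(n) = (M-1)^(n+1), and
-- (M-1)^(n+1) / M = (M-1)(M+1)⋯(M+n-1) ≡ (M-1)(n-1)! (mod M).  The right-hand side is
-- -n! B(2,n) = -(n-1)!/(n+1), so (n+1) (M⁻¹ Σ_{x<M} x^(n) - rhs) is an integer multiple of M.
-- For M = p^N and n+1 = p^v b with p ∤ b the difference thus has p-adic valuation ≥ N - v.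
module Submission where

open import Defs
open import Level using (0ℓ)
open import Data.Product using (∃; _×_; _,_)
open import Data.Nat as ℕ using (ℕ; zero; suc; _+_; _*_; _^_; _≤_; _<_; _!; NonZero)
import Data.Nat.Properties as ℕP
open import Data.Nat.Induction using (<-rec)
open import Data.Nat.Divisibility using (_∣_; _∣?_; divides)
open import Data.Nat.Primality using (Prime; prime⇒nonZero; prime⇒nonTrivial)
open import Data.Nat.Combinatorics using (_C_; nCk+nC[k+1]≡[n+1]C[k+1])
open import Data.Nat.Combinatorics.Specification using (k>n⇒nCk≡0)
import Data.Nat.Tactic.RingSolver as ℕ-Solver
open import Data.Integer as ℤ using (+_)
import Data.Integer.Properties as ℤP
import Data.Integer.Tactic.RingSolver as ℤ-Solver
open import Data.Rational as ℚ using (ℚ; _/_; 0ℚ; 1ℚ; fromℚᵘ)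
import Data.Rational.Properties as ℚP
open import Data.Rational.Unnormalised as ℚᵘ using (mkℚᵘ; *≡*)
import Data.Rational.Unnormalised.Properties as ℚᵘP
open import Relation.Nullary using (¬_; yes; no)
open import Relation.Nullary.Decidable using (dec⇒maybe)
open import Relation.Binary.PropositionalEquality
import Tactic.RingSolver as Solver
import Tactic.RingSolver.Core.AlmostCommutativeRing as ACR

ℚ-ring : ACR.AlmostCommutativeRing 0ℓ 0ℓ
ℚ-ring = ACR.fromCommutativeRing ℚP.+-*-commutativeRing λ x → dec⇒maybe (0ℚ ℚP.≟ x)

fromℚᵘ-homo-+ : ∀ x y → fromℚᵘ (x ℚᵘ.+ y) ≡ fromℚᵘ x ℚ.+ fromℚᵘ y
fromℚᵘ-homo-+ x y = ℚP.toℚᵘ-injective (ℚᵘP.≃-trans (ℚP.toℚᵘ-fromℚᵘ _)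
  (ℚᵘP.≃-trans (ℚᵘP.+-cong (ℚᵘP.≃-sym (ℚP.toℚᵘ-fromℚᵘ x)) (ℚᵘP.≃-sym (ℚP.toℚᵘ-fromℚᵘ y)))
    (ℚᵘP.≃-sym (ℚP.toℚᵘ-homo-+ (fromℚᵘ x) (fromℚᵘ y)))))

fromℚᵘ-homo-* : ∀ x y → fromℚᵘ (x ℚᵘ.* y) ≡ fromℚᵘ x ℚ.* fromℚᵘ y
fromℚᵘ-homo-* x y = ℚP.toℚᵘ-injective (ℚᵘP.≃-trans (ℚP.toℚᵘ-fromℚᵘ _)
  (ℚᵘP.≃-trans (ℚᵘP.*-cong (ℚᵘP.≃-sym (ℚP.toℚᵘ-fromℚᵘ x)) (ℚᵘP.≃-sym (ℚP.toℚᵘ-fromℚᵘ y)))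
    (ℚᵘP.≃-sym (ℚP.toℚᵘ-homo-* (fromℚᵘ x) (fromℚᵘ y)))))

fromℚᵘ-homo-neg : ∀ x → fromℚᵘ (ℚᵘ.- x) ≡ ℚ.- fromℚᵘ x
fromℚᵘ-homo-neg x = ℚP.toℚᵘ-injective (ℚᵘP.≃-trans (ℚP.toℚᵘ-fromℚᵘ _)
  (ℚᵘP.≃-trans (ℚᵘP.-‿cong (ℚᵘP.≃-sym (ℚP.toℚᵘ-fromℚᵘ x)))
    (ℚᵘP.≃-sym (ℚP.toℚᵘ-homo‿- (fromℚᵘ x)))))

ℤtoℚ-homo-+ : ∀ a b → ℤtoℚ (a ℤ.+ b) ≡ ℤtoℚ a ℚ.+ ℤtoℚ b
ℤtoℚ-homo-+ a b =
  trans (ℚP.fromℚᵘ-cong {mkℚᵘ (a ℤ.+ b) 0} {mkℚᵘ a 0 ℚᵘ.+ mkℚᵘ b 0} (*≡* (cross-multiplied a b)))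
        (fromℚᵘ-homo-+ (mkℚᵘ a 0) (mkℚᵘ b 0))
  where
  cross-multiplied : ∀ a b → (a ℤ.+ b) ℤ.* + 1 ≡ (a ℤ.* + 1 ℤ.+ b ℤ.* + 1) ℤ.* + 1
  cross-multiplied = ℤ-Solver.solve-∀

ℤtoℚ-homo-* : ∀ a b → ℤtoℚ (a ℤ.* b) ≡ ℤtoℚ a ℚ.* ℤtoℚ b
ℤtoℚ-homo-* a b = fromℚᵘ-homo-* (mkℚᵘ a 0) (mkℚᵘ b 0)

ℤtoℚ-homo-neg : ∀ a → ℤtoℚ (ℤ.- a) ≡ ℚ.- ℤtoℚ a
ℤtoℚ-homo-neg a = fromℚᵘ-homo-neg (mkℚᵘ a 0)

ℕtoℚ : ℕ → ℚ
ℕtoℚ n = ℤtoℚ (+ n)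

ℕtoℚ-homo-+ : ∀ a b → ℕtoℚ (a + b) ≡ ℕtoℚ a ℚ.+ ℕtoℚ b
ℕtoℚ-homo-+ a b = trans (cong ℤtoℚ (ℤP.pos-+ a b)) (ℤtoℚ-homo-+ (+ a) (+ b))

ℕtoℚ-homo-* : ∀ a b → ℕtoℚ (a * b) ≡ ℕtoℚ a ℚ.* ℕtoℚ b
ℕtoℚ-homo-* a b = trans (cong ℤtoℚ (ℤP.pos-* a b)) (ℤtoℚ-homo-* (+ a) (+ b))

/-≡-*-1/ : ∀ z d .{{_ : NonZero d}} → z / d ≡ ℤtoℚ z ℚ.* (+ 1 / d)
/-≡-*-1/ z (suc d) =
  trans (ℚP.fromℚᵘ-cong {mkℚᵘ z d} {mkℚᵘ z 0 ℚᵘ.* mkℚᵘ (+ 1) d} (*≡* cross-multiplied))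
        (fromℚᵘ-homo-* (mkℚᵘ z 0) (mkℚᵘ (+ 1) d))
  where
  cross-multiplied : z ℤ.* + suc (d + 0) ≡ (z ℤ.* + 1) ℤ.* + suc d
  cross-multiplied = cong₂ (λ x y → x ℤ.* + suc y) (sym (ℤP.*-identityʳ z)) (ℕP.+-identityʳ d)

1/n*n≡1 : ∀ n .{{_ : NonZero n}} → (+ 1 / n) ℚ.* ℕtoℚ n ≡ 1ℚ
1/n*n≡1 (suc n) =
  trans (sym (fromℚᵘ-homo-* (mkℚᵘ (+ 1) n) (mkℚᵘ (+ suc n) 0)))
        (ℚP.fromℚᵘ-cong {mkℚᵘ (+ 1) n ℚᵘ.* mkℚᵘ (+ suc n) 0} {mkℚᵘ (+ 1) 0} (*≡* cross-multiplied))
  where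
  cross-multiplied : + 1 ℤ.* + suc n ℤ.* + 1 ≡ + 1 ℤ.* + suc (n * 1)
  cross-multiplied = trans (ℤP.*-identityʳ _) (cong (λ k → + 1 ℤ.* + suc k) (sym (ℕP.*-identityʳ n)))

1/n*[n*m]≡m : ∀ n .{{_ : NonZero n}} m → (+ 1 / n) ℚ.* ℕtoℚ (n * m) ≡ ℕtoℚ m
1/n*[n*m]≡m n m = begin
  (+ 1 / n) ℚ.* ℕtoℚ (n * m)         ≡⟨ cong ((+ 1 / n) ℚ.*_) (ℕtoℚ-homo-* n m) ⟩
  (+ 1 / n) ℚ.* (ℕtoℚ n ℚ.* ℕtoℚ m)  ≡⟨ ℚP.*-assoc (+ 1 / n) (ℕtoℚ n) (ℕtoℚ m) ⟨
  (+ 1 / n) ℚ.* ℕtoℚ n ℚ.* ℕtoℚ m    ≡⟨ cong (ℚ._* ℕtoℚ m) (1/n*n≡1 n) ⟩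
  1ℚ ℚ.* ℕtoℚ m                      ≡⟨ ℚP.*-identityˡ (ℕtoℚ m) ⟩
  ℕtoℚ m                             ∎
  where open ≡-Reasoning

ℕtoℚ-*-cancelˡ : ∀ n .{{_ : NonZero n}} {x y} → ℕtoℚ n ℚ.* x ≡ ℕtoℚ n ℚ.* y → x ≡ y
ℕtoℚ-*-cancelˡ n {x} {y} eq = begin
  x                                  ≡⟨ ℚP.*-identityˡ x ⟨
  1ℚ ℚ.* x                           ≡⟨ cong (ℚ._* x) (1/n*n≡1 n) ⟨
  (+ 1 / n) ℚ.* ℕtoℚ n ℚ.* x         ≡⟨ ℚP.*-assoc (+ 1 / n) (ℕtoℚ n) x ⟩
  (+ 1 / n) ℚ.* (ℕtoℚ n ℚ.* x)       ≡⟨ cong ((+ 1 / n) ℚ.*_) eq ⟩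
  (+ 1 / n) ℚ.* (ℕtoℚ n ℚ.* y)       ≡⟨ ℚP.*-assoc (+ 1 / n) (ℕtoℚ n) y ⟨
  (+ 1 / n) ℚ.* ℕtoℚ n ℚ.* y         ≡⟨ cong (ℚ._* y) (1/n*n≡1 n) ⟩
  1ℚ ℚ.* y                           ≡⟨ ℚP.*-identityˡ y ⟩
  y                                  ∎
  where open ≡-Reasoning

sumBelow-cong : ∀ n {f g} → (∀ j → f j ≡ g j) → sumBelow n f ≡ sumBelow n g
sumBelow-cong zero    f≗g = refl
sumBelow-cong (suc n) f≗g = cong₂ ℚ._+_ (sumBelow-cong n f≗g) (f≗g n)

sumBelow-sub : ∀ n f g → sumBelow n (λ j → f j ℚ.- g j) ≡ sumBelow n f ℚ.- sumBelow n g
sumBelow-sub zero    f g = refl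
sumBelow-sub (suc n) f g = trans (cong (ℚ._+ (f n ℚ.- g n)) (sumBelow-sub n f g))
  (interchange (sumBelow n f) (sumBelow n g) (f n) (g n))
  where
  interchange : ∀ a b c d → a ℚ.- b ℚ.+ (c ℚ.- d) ≡ a ℚ.+ c ℚ.- (b ℚ.+ d)
  interchange = Solver.solve-∀ ℚ-ring

sumBelow-*ˡ : ∀ n c f → sumBelow n (λ j → c ℚ.* f j) ≡ c ℚ.* sumBelow n f
sumBelow-*ˡ zero    c f = sym (ℚP.*-zeroʳ c)
sumBelow-*ˡ (suc n) c f = trans (cong (ℚ._+ (c ℚ.* f n)) (sumBelow-*ˡ n c f))
  (sym (ℚP.*-distribˡ-+ c (sumBelow n f) (f n)))

sumBelow-suc : ∀ n f → sumBelow (suc n) f ≡ f 0 ℚ.+ sumBelow n (λ j → f (suc j))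
sumBelow-suc zero    f = ℚP.+-comm 0ℚ (f 0)
sumBelow-suc (suc n) f = trans (cong (ℚ._+ f (suc n)) (sumBelow-suc n f))
  (ℚP.+-assoc (f 0) (sumBelow n (λ j → f (suc j))) (f (suc n)))

sumBelowℕ : ℕ → (ℕ → ℕ) → ℕ
sumBelowℕ zero    f = 0
sumBelowℕ (suc n) f = sumBelowℕ n f + f n

sumBelow-ℕtoℚ : ∀ n f → sumBelow n (λ j → ℕtoℚ (f j)) ≡ ℕtoℚ (sumBelowℕ n f)
sumBelow-ℕtoℚ zero    f = refl
sumBelow-ℕtoℚ (suc n) f = trans (cong (ℚ._+ ℕtoℚ (f n)) (sumBelow-ℕtoℚ n f))
  (sym (ℕtoℚ-homo-+ (sumBelowℕ n f) (f n)))

rising-suc : ∀ m n → rising m (suc n) ≡ m * rising (suc m) n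
rising-suc m zero    = trans (ℕP.+-identityʳ (m + 0)) (trans (ℕP.+-identityʳ m) (sym (ℕP.*-identityʳ m)))
rising-suc m (suc n) = begin
  rising m (suc n) * (m + suc n)      ≡⟨ cong₂ _*_ (rising-suc m n) (ℕP.+-suc m n) ⟩
  m * rising (suc m) n * (suc m + n)  ≡⟨ ℕP.*-assoc m _ _ ⟩
  m * rising (suc m) (suc n)          ∎
  where open ≡-Reasoning

rising-1 : ∀ n → rising 1 n ≡ n !
rising-1 zero    = refl
rising-1 (suc n) = trans (cong (_* suc n) (rising-1 n)) (ℕP.*-comm (n !) (suc n))

rising-+-≡-mod : ∀ a M n → ∃ λ h → rising (a + M) n ≡ rising a n + M * h
rising-+-≡-mod a M zero    = 0 , sym (cong suc (ℕP.*-zeroʳ M))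
rising-+-≡-mod a M (suc n) with rising-+-≡-mod a M n
... | h , eq = rising a n + h * (a + M + n) , (begin
  rising (a + M) n * (a + M + n)                 ≡⟨ cong (_* (a + M + n)) eq ⟩
  (rising a n + M * h) * (a + M + n)             ≡⟨ expand (rising a n) M h a n ⟩
  rising a n * (a + n) + M * (rising a n + h * (a + M + n)) ∎)
  where
  open ≡-Reasoning
  expand : ∀ r M h a n → (r + M * h) * (a + M + n) ≡ r * (a + n) + M * (r + h * (a + M + n))
  expand = ℕ-Solver.solve-∀

rising-telescope : ∀ m n → rising m (suc n) + suc n * rising (suc m) n ≡ rising (suc m) (suc n)
rising-telescope m n = begin
  rising m (suc n) + suc n * R  ≡⟨ cong (_+ suc n * R) (rising-suc m n) ⟩
  m * R + suc n * R             ≡⟨ collect m n R ⟩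
  R * (suc m + n)               ∎
  where
  open ≡-Reasoning
  R : ℕ
  R = rising (suc m) n
  collect : ∀ m n R → m * R + suc n * R ≡ R * (suc m + n)
  collect = ℕ-Solver.solve-∀

sumBelowℕ-rising : ∀ n m → suc (suc n) * sumBelowℕ (suc m) (λ x → rising x (suc n)) ≡ rising m (suc (suc n))
sumBelowℕ-rising n zero    = begin
  suc (suc n) * rising 0 (suc n)  ≡⟨ cong (suc (suc n) *_) (rising-suc 0 n) ⟩
  suc (suc n) * 0                 ≡⟨ ℕP.*-zeroʳ (suc (suc n)) ⟩
  0                               ≡⟨ rising-suc 0 (suc n) ⟨
  rising 0 (suc (suc n))          ∎
  where open ≡-Reasoning
sumBelowℕ-rising n (suc m) = begin
  suc (suc n) * (S + R)                         ≡⟨ ℕP.*-distribˡ-+ (suc (suc n)) S R ⟩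
  suc (suc n) * S + suc (suc n) * R             ≡⟨ cong (_+ suc (suc n) * R) (sumBelowℕ-rising n m) ⟩
  rising m (suc (suc n)) + suc (suc n) * R      ≡⟨ rising-telescope m (suc n) ⟩
  rising (suc m) (suc (suc n))                  ∎
  where
  open ≡-Reasoning
  S R : ℕ
  S = sumBelowℕ (suc m) (λ x → rising x (suc n))
  R = rising (suc m) (suc n)

sumBelowℕ-rising-≡-mod : ∀ n m → ∃ λ h →
  suc (suc n) * sumBelowℕ (suc m) (λ x → rising x (suc n)) ≡ suc m * (m * (n ! + suc m * h))
sumBelowℕ-rising-≡-mod n m with rising-+-≡-mod 1 (suc m) n
... | h , eq = h , (begin
  suc (suc n) * sumBelowℕ (suc m) (λ x → rising x (suc n))  ≡⟨ sumBelowℕ-rising n m ⟩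
  rising m (suc (suc n))                     ≡⟨ rising-suc m (suc n) ⟩
  m * rising (suc m) (suc n)                 ≡⟨ cong (m *_) (rising-suc (suc m) n) ⟩
  m * (suc m * rising (suc (suc m)) n)       ≡⟨ cong (λ r → m * (suc m * r)) eq ⟩
  m * (suc m * (rising 1 n + suc m * h))     ≡⟨ cong (λ r → m * (suc m * (r + suc m * h))) (rising-1 n) ⟩
  m * (suc m * (n ! + suc m * h))            ≡⟨ swap m (suc m) (n ! + suc m * h) ⟩
  suc m * (m * (n ! + suc m * h))            ∎)
  where
  open ≡-Reasoning
  swap : ∀ a b c → a * (b * c) ≡ b * (a * c)
  swap = ℕ-Solver.solve-∀

sign : ℕ → ℚ
sign zero    = 1ℚ
sign (suc j) = ℚ.- sign j

ℤtoℚ-[-1]^ : ∀ j → ℤtoℚ ((ℤ.- + 1) ℤ.^ j) ≡ sign j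
ℤtoℚ-[-1]^ zero    = refl
ℤtoℚ-[-1]^ (suc j) = begin
  ℤtoℚ ((ℤ.- + 1) ℤ.* (ℤ.- + 1) ℤ.^ j)      ≡⟨ ℤtoℚ-homo-* (ℤ.- + 1) ((ℤ.- + 1) ℤ.^ j) ⟩
  ℤtoℚ (ℤ.- + 1) ℚ.* ℤtoℚ ((ℤ.- + 1) ℤ.^ j)  ≡⟨ cong₂ ℚ._*_ (ℤtoℚ-homo-neg (+ 1)) (ℤtoℚ-[-1]^ j) ⟩
  (ℚ.- 1ℚ) ℚ.* sign j                        ≡⟨ ℚP.neg-distribˡ-* 1ℚ (sign j) ⟨
  ℚ.- (1ℚ ℚ.* sign j)                        ≡⟨ cong ℚ.-_ (ℚP.*-identityˡ (sign j)) ⟩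
  ℚ.- sign j                                 ∎
  where open ≡-Reasoning

-- betaSum m b is the binomial expansion of ∫₀¹ xᵇ (1-x)ᵐ dx = B(b+1, m+1).
betaTerm : ℕ → ℕ → ℕ → ℚ
betaTerm m b j = sign j ℚ.* ℕtoℚ (m C j) ℚ.* (+ 1 / suc (j + b))

betaSum : ℕ → ℕ → ℚ
betaSum m b = sumBelow (suc m) (betaTerm m b)

betaTerm-pascal : ∀ m b i → betaTerm (suc m) b (suc i) ≡ betaTerm m b (suc i) ℚ.- betaTerm m (suc b) i
betaTerm-pascal m b i = begin
  ℚ.- s ℚ.* ℕtoℚ (suc m C suc i) ℚ.* v
    ≡⟨ cong (λ c → ℚ.- s ℚ.* ℕtoℚ c ℚ.* v) (nCk+nC[k+1]≡[n+1]C[k+1] m i) ⟨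
  ℚ.- s ℚ.* ℕtoℚ (m C i + m C suc i) ℚ.* v
    ≡⟨ cong (λ c → ℚ.- s ℚ.* c ℚ.* v) (ℕtoℚ-homo-+ (m C i) (m C suc i)) ⟩
  ℚ.- s ℚ.* (ℕtoℚ (m C i) ℚ.+ ℕtoℚ (m C suc i)) ℚ.* v
    ≡⟨ split s (ℕtoℚ (m C i)) (ℕtoℚ (m C suc i)) v ⟩
  ℚ.- s ℚ.* ℕtoℚ (m C suc i) ℚ.* v ℚ.- s ℚ.* ℕtoℚ (m C i) ℚ.* v
    ≡⟨ cong (λ k → betaTerm m b (suc i) ℚ.- s ℚ.* ℕtoℚ (m C i) ℚ.* (+ 1 / suc k)) (ℕP.+-suc i b) ⟨
  betaTerm m b (suc i) ℚ.- betaTerm m (suc b) i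
    ∎
  where
  open ≡-Reasoning
  s v : ℚ
  s = sign i
  v = + 1 / suc (suc i + b)
  split : ∀ s x y v → ℚ.- s ℚ.* (x ℚ.+ y) ℚ.* v ≡ ℚ.- s ℚ.* y ℚ.* v ℚ.- s ℚ.* x ℚ.* v
  split = Solver.solve-∀ ℚ-ring

betaTerm-vanishes : ∀ m b → betaTerm m b (suc m) ≡ 0ℚ
betaTerm-vanishes m b = begin
  sign (suc m) ℚ.* ℕtoℚ (m C suc m) ℚ.* v
    ≡⟨ cong (λ c → sign (suc m) ℚ.* ℕtoℚ c ℚ.* v) (k>n⇒nCk≡0 (ℕP.n<1+n m)) ⟩
  sign (suc m) ℚ.* 0ℚ ℚ.* v               ≡⟨ cong (ℚ._* v) (ℚP.*-zeroʳ (sign (suc m))) ⟩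
  0ℚ ℚ.* v                                ≡⟨ ℚP.*-zeroˡ v ⟩
  0ℚ                                      ∎
  where
  open ≡-Reasoning
  v : ℚ
  v = + 1 / suc (suc m + b)

betaSum-pascal : ∀ m b → betaSum (suc m) b ≡ betaSum m b ℚ.- betaSum m (suc b)
betaSum-pascal m b = begin
  betaSum (suc m) b
    ≡⟨ sumBelow-suc (suc m) (betaTerm (suc m) b) ⟩
  betaTerm m b 0 ℚ.+ sumBelow (suc m) (λ i → betaTerm (suc m) b (suc i))
    ≡⟨ cong (betaTerm m b 0 ℚ.+_) (trans (sumBelow-cong (suc m) (betaTerm-pascal m b)) (sumBelow-sub (suc m) _ _)) ⟩
  betaTerm m b 0 ℚ.+ (sumBelow (suc m) (λ i → betaTerm m b (suc i)) ℚ.- betaSum m (suc b))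
    ≡⟨ ℚP.+-assoc (betaTerm m b 0) _ _ ⟨
  betaTerm m b 0 ℚ.+ sumBelow (suc m) (λ i → betaTerm m b (suc i)) ℚ.- betaSum m (suc b)
    ≡⟨ cong (ℚ._- betaSum m (suc b)) (sumBelow-suc (suc m) (betaTerm m b)) ⟨
  betaSum m b ℚ.+ betaTerm m b (suc m) ℚ.- betaSum m (suc b)
    ≡⟨ cong (λ t → betaSum m b ℚ.+ t ℚ.- betaSum m (suc b)) (betaTerm-vanishes m b) ⟩
  betaSum m b ℚ.+ 0ℚ ℚ.- betaSum m (suc b)
    ≡⟨ cong (ℚ._- betaSum m (suc b)) (ℚP.+-identityʳ (betaSum m b)) ⟩
  betaSum m b ℚ.- betaSum m (suc b)
    ∎
  where open ≡-Reasoning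

betaSum-closed : ∀ m b → betaSum m b ℚ.* ℕtoℚ (suc (m + b) !) ≡ ℕtoℚ (m ! * b !)
betaSum-closed zero b = begin
  (0ℚ ℚ.+ 1ℚ ℚ.* 1ℚ ℚ.* (+ 1 / suc b)) ℚ.* ℕtoℚ (suc b * b !)  ≡⟨ simplify (+ 1 / suc b) (ℕtoℚ (suc b * b !)) ⟩
  (+ 1 / suc b) ℚ.* ℕtoℚ (suc b * b !)                          ≡⟨ 1/n*[n*m]≡m (suc b) (b !) ⟩
  ℕtoℚ (b !)                                                   ≡⟨ cong ℕtoℚ (ℕP.*-identityˡ (b !)) ⟨
  ℕtoℚ (1 * b !)                                               ∎
  where
  open ≡-Reasoning
  simplify : ∀ u x → (0ℚ ℚ.+ 1ℚ ℚ.* 1ℚ ℚ.* u) ℚ.* x ≡ u ℚ.* x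
  simplify = Solver.solve-∀ ℚ-ring
betaSum-closed (suc m) b = begin
  betaSum (suc m) b ℚ.* ℕtoℚ (K * F)
    ≡⟨ cong₂ ℚ._*_ (betaSum-pascal m b) (ℕtoℚ-homo-* K F) ⟩
  (betaSum m b ℚ.- betaSum m (suc b)) ℚ.* (ℕtoℚ K ℚ.* ℕtoℚ F)
    ≡⟨ distribute (betaSum m b) (betaSum m (suc b)) (ℕtoℚ K) (ℕtoℚ F) ⟩
  ℕtoℚ K ℚ.* (betaSum m b ℚ.* ℕtoℚ F) ℚ.- betaSum m (suc b) ℚ.* (ℕtoℚ K ℚ.* ℕtoℚ F)
    ≡⟨ cong (λ x → ℕtoℚ K ℚ.* (betaSum m b ℚ.* ℕtoℚ F) ℚ.- betaSum m (suc b) ℚ.* x) K*F≡ ⟩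
  ℕtoℚ K ℚ.* (betaSum m b ℚ.* ℕtoℚ F) ℚ.- betaSum m (suc b) ℚ.* ℕtoℚ (suc (m + suc b) !)
    ≡⟨ cong₂ (λ x y → ℕtoℚ K ℚ.* x ℚ.- y) (betaSum-closed m b) (betaSum-closed m (suc b)) ⟩
  ℕtoℚ K ℚ.* ℕtoℚ (m ! * b !) ℚ.- ℕtoℚ (m ! * suc b !)
    ≡⟨ cong (ℚ._- ℕtoℚ (m ! * suc b !)) (trans (sym (ℕtoℚ-homo-* K (m ! * b !))) (cong ℕtoℚ (factorials m b (m !) (b !)))) ⟩
  ℕtoℚ (m ! * suc b ! + suc m ! * b !) ℚ.- ℕtoℚ (m ! * suc b !)
    ≡⟨ cong (ℚ._- ℕtoℚ (m ! * suc b !)) (ℕtoℚ-homo-+ (m ! * suc b !) (suc m ! * b !)) ⟩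
  ℕtoℚ (m ! * suc b !) ℚ.+ ℕtoℚ (suc m ! * b !) ℚ.- ℕtoℚ (m ! * suc b !)
    ≡⟨ cancel (ℕtoℚ (m ! * suc b !)) (ℕtoℚ (suc m ! * b !)) ⟩
  ℕtoℚ (suc m ! * b !)
    ∎
  where
  open ≡-Reasoning
  K F : ℕ
  K = suc (suc (m + b))
  F = suc (m + b) !
  K*F≡ : ℕtoℚ K ℚ.* ℕtoℚ F ≡ ℕtoℚ (suc (m + suc b) !)
  K*F≡ = trans (sym (ℕtoℚ-homo-* K F)) (cong (λ x → ℕtoℚ (suc x !)) (sym (ℕP.+-suc m b)))
  distribute : ∀ x y k f → (x ℚ.- y) ℚ.* (k ℚ.* f) ≡ k ℚ.* (x ℚ.* f) ℚ.- y ℚ.* (k ℚ.* f)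
  distribute = Solver.solve-∀ ℚ-ring
  factorials : ∀ m b X Y → suc (suc (m + b)) * (X * Y) ≡ X * (suc b * Y) + suc m * X * Y
  factorials = ℕ-Solver.solve-∀
  cancel : ∀ x y → x ℚ.+ y ℚ.- x ≡ y
  cancel = Solver.solve-∀ ℚ-ring

rhs[1+m]≡-[1+m]!*betaSum : ∀ m → rhs (suc m) ≡ ℚ.- ℕtoℚ (suc m !) ℚ.* betaSum m 1
rhs[1+m]≡-[1+m]!*betaSum m = trans (sumBelow-cong (suc m) term≡) (sumBelow-*ˡ (suc m) (ℚ.- ℕtoℚ (suc m !)) (betaTerm m 1))
  where
  open ≡-Reasoning
  F : ℚ
  F = ℕtoℚ (suc m !)
  rearrange : ∀ s f c v → (ℚ.- s) ℚ.* (f ℚ.* c) ℚ.* v ≡ (ℚ.- f) ℚ.* (s ℚ.* c ℚ.* v)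
  rearrange = Solver.solve-∀ ℚ-ring
  term≡ : ∀ j → ((ℤ.- + 1) ℤ.^ suc j ℤ.* + (suc m ! * (m C j))) / suc (suc j) ≡ (ℚ.- F) ℚ.* betaTerm m 1 j
  term≡ j = begin
    ((ℤ.- + 1) ℤ.^ suc j ℤ.* + (suc m ! * (m C j))) / suc (suc j)
      ≡⟨ /-≡-*-1/ ((ℤ.- + 1) ℤ.^ suc j ℤ.* + (suc m ! * (m C j))) (suc (suc j)) ⟩
    ℤtoℚ ((ℤ.- + 1) ℤ.^ suc j ℤ.* + (suc m ! * (m C j))) ℚ.* (+ 1 / suc (suc j))
      ≡⟨ cong (ℚ._* (+ 1 / suc (suc j))) (trans (ℤtoℚ-homo-* ((ℤ.- + 1) ℤ.^ suc j) (+ (suc m ! * (m C j))))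
           (cong₂ ℚ._*_ (ℤtoℚ-[-1]^ (suc j)) (ℕtoℚ-homo-* (suc m !) (m C j)))) ⟩
    (ℚ.- sign j) ℚ.* (F ℚ.* ℕtoℚ (m C j)) ℚ.* (+ 1 / suc (suc j))
      ≡⟨ rearrange (sign j) F (ℕtoℚ (m C j)) (+ 1 / suc (suc j)) ⟩
    (ℚ.- F) ℚ.* (sign j ℚ.* ℕtoℚ (m C j) ℚ.* (+ 1 / suc (suc j)))
      ≡⟨ cong (λ k → (ℚ.- F) ℚ.* (sign j ℚ.* ℕtoℚ (m C j) ℚ.* (+ 1 / suc k))) (ℕP.+-comm 1 j) ⟩
    (ℚ.- F) ℚ.* betaTerm m 1 j
      ∎

rhs[1+m]*[2+m]≡-m! : ∀ m → rhs (suc m) ℚ.* ℕtoℚ (suc (suc m)) ≡ ℚ.- ℕtoℚ (m !)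
rhs[1+m]*[2+m]≡-m! m = begin
  rhs (suc m) ℚ.* ℕtoℚ (suc (suc m))
    ≡⟨ cong (ℚ._* ℕtoℚ (suc (suc m))) (rhs[1+m]≡-[1+m]!*betaSum m) ⟩
  (ℚ.- ℕtoℚ (suc m !)) ℚ.* betaSum m 1 ℚ.* ℕtoℚ (suc (suc m))
    ≡⟨ rearrange (ℕtoℚ (suc m !)) (betaSum m 1) (ℕtoℚ (suc (suc m))) ⟩
  ℚ.- (betaSum m 1 ℚ.* (ℕtoℚ (suc (suc m)) ℚ.* ℕtoℚ (suc m !)))
    ≡⟨ cong (λ x → ℚ.- (betaSum m 1 ℚ.* x)) (trans (sym (ℕtoℚ-homo-* (suc (suc m)) (suc m !)))
         (cong (λ x → ℕtoℚ (suc x !)) (ℕP.+-comm 1 m))) ⟩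
  ℚ.- (betaSum m 1 ℚ.* ℕtoℚ (suc (m + 1) !))
    ≡⟨ cong ℚ.-_ (betaSum-closed m 1) ⟩
  ℚ.- ℕtoℚ (m ! * 1)
    ≡⟨ cong (λ x → ℚ.- ℕtoℚ x) (ℕP.*-identityʳ (m !)) ⟩
  ℚ.- ℕtoℚ (m !)
    ∎
  where
  open ≡-Reasoning
  rearrange : ∀ f b k → (ℚ.- f) ℚ.* b ℚ.* k ≡ ℚ.- (b ℚ.* (k ℚ.* f))
  rearrange = Solver.solve-∀ ℚ-ring

riemannSum-rising-error : ∀ n M .{{_ : NonZero M}} → ∃ λ X →
  ((+ 1 / M) ℚ.* sumBelow M (λ x → ℕtoℚ (rising x (suc n))) ℚ.- rhs (suc n)) ℚ.* ℕtoℚ (suc (suc n))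
    ≡ ℕtoℚ (M * X)
riemannSum-rising-error n (suc m) with sumBelowℕ-rising-≡-mod n m
... | h , sum≡ = n ! + m * h , (begin
  (u ℚ.* S ℚ.- rhs (suc n)) ℚ.* N₂
    ≡⟨ distribute u S (rhs (suc n)) N₂ ⟩
  u ℚ.* (N₂ ℚ.* S) ℚ.- rhs (suc n) ℚ.* N₂
    ≡⟨ cong₂ (λ x y → u ℚ.* x ℚ.- y) N₂*S≡ (rhs[1+m]*[2+m]≡-m! n) ⟩
  u ℚ.* ℕtoℚ (suc m * (m * (n ! + suc m * h))) ℚ.- ℚ.- ℕtoℚ (n !)
    ≡⟨ cong (ℚ._- ℚ.- ℕtoℚ (n !)) (1/n*[n*m]≡m (suc m) (m * (n ! + suc m * h))) ⟩
  ℕtoℚ (m * (n ! + suc m * h)) ℚ.- ℚ.- ℕtoℚ (n !)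
    ≡⟨ x--y≡x+y (ℕtoℚ (m * (n ! + suc m * h))) (ℕtoℚ (n !)) ⟩
  ℕtoℚ (m * (n ! + suc m * h)) ℚ.+ ℕtoℚ (n !)
    ≡⟨ ℕtoℚ-homo-+ (m * (n ! + suc m * h)) (n !) ⟨
  ℕtoℚ (m * (n ! + suc m * h) + n !)
    ≡⟨ cong ℕtoℚ (regroup m (n !) h) ⟩
  ℕtoℚ (suc m * (n ! + m * h))
    ∎)
  where
  open ≡-Reasoning
  u S N₂ : ℚ
  u = + 1 / suc m
  S = sumBelow (suc m) (λ x → ℕtoℚ (rising x (suc n)))
  N₂ = ℕtoℚ (suc (suc n))
  N₂*S≡ : N₂ ℚ.* S ≡ ℕtoℚ (suc m * (m * (n ! + suc m * h)))
  N₂*S≡ = begin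
    N₂ ℚ.* S
      ≡⟨ cong (N₂ ℚ.*_) (sumBelow-ℕtoℚ (suc m) (λ x → rising x (suc n))) ⟩
    N₂ ℚ.* ℕtoℚ (sumBelowℕ (suc m) (λ x → rising x (suc n)))
      ≡⟨ ℕtoℚ-homo-* (suc (suc n)) (sumBelowℕ (suc m) (λ x → rising x (suc n))) ⟨
    ℕtoℚ (suc (suc n) * sumBelowℕ (suc m) (λ x → rising x (suc n)))
      ≡⟨ cong ℕtoℚ sum≡ ⟩
    ℕtoℚ (suc m * (m * (n ! + suc m * h)))
      ∎
  distribute : ∀ u S r N → (u ℚ.* S ℚ.- r) ℚ.* N ≡ u ℚ.* (N ℚ.* S) ℚ.- r ℚ.* N
  distribute = Solver.solve-∀ ℚ-ring
  x--y≡x+y : ∀ x y → x ℚ.- ℚ.- y ≡ x ℚ.+ y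
  x--y≡x+y = Solver.solve-∀ ℚ-ring
  regroup : ∀ m F h → m * (F + suc m * h) + F ≡ suc m * (F + m * h)
  regroup = ℕ-Solver.solve-∀

p-power-decomposition : ∀ {p} → 1 < p → ∀ c → 0 < c → ∃ λ v → ∃ λ b → c ≡ p ^ v * b × ¬ p ∣ b
p-power-decomposition {p} 1<p = <-rec _ decompose
  where
  decompose : ∀ c → (∀ {q} → q < c → 0 < q → ∃ λ v → ∃ λ b → q ≡ p ^ v * b × ¬ p ∣ b) →
              0 < c → ∃ λ v → ∃ λ b → c ≡ p ^ v * b × ¬ p ∣ b
  decompose c rec 0<c with p ∣? c
  ... | no p∤c = 0 , c , sym (ℕP.+-identityʳ c) , p∤c
  ... | yes (divides q c≡q*p) with rec q<c 0<q
    where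
    0<q : 0 < q
    0<q = ℕP.n≢0⇒n>0 λ q≡0 → ℕP.<⇒≢ 0<c (sym (trans c≡q*p (cong (_* p) q≡0)))
    q<c : q < c
    q<c = subst (q <_) (sym c≡q*p) (ℕP.m<m*n q p {{ℕ.>-nonZero 0<q}} 1<p)
  ... | v , b , q≡p^v*b , p∤b = suc v , b , trans c≡q*p (trans (cong (_* p) q≡p^v*b) (reassociate (p ^ v) b p)) , p∤b
    where
    reassociate : ∀ x b p → x * b * p ≡ p * x * b
    reassociate = ℕ-Solver.solve-∀

pAdicValAtLeast-cancel-p^v : ∀ {p} .{{_ : NonZero p}} {k v b M d X} e → ¬ p ∣ b → M ≡ p ^ (k + v) * d →
  e ℚ.* ℕtoℚ (p ^ v * b) ≡ ℕtoℚ (M * X) → pAdicValAtLeast p k e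
pAdicValAtLeast-cancel-p^v {p} {k} {v} {b} {M} {d} {X} e p∤b M≡ eq =
  + (d * X) , b , p∤b , ℕtoℚ-*-cancelˡ (p ^ v) {{ℕP.m^n≢0 p v}} (begin
    ℕtoℚ (p ^ v) ℚ.* (e ℚ.* ℕtoℚ b)      ≡⟨ ℚP.*-assoc (ℕtoℚ (p ^ v)) e (ℕtoℚ b) ⟨
    ℕtoℚ (p ^ v) ℚ.* e ℚ.* ℕtoℚ b        ≡⟨ cong (ℚ._* ℕtoℚ b) (ℚP.*-comm (ℕtoℚ (p ^ v)) e) ⟩
    e ℚ.* ℕtoℚ (p ^ v) ℚ.* ℕtoℚ b        ≡⟨ ℚP.*-assoc e (ℕtoℚ (p ^ v)) (ℕtoℚ b) ⟩
    e ℚ.* (ℕtoℚ (p ^ v) ℚ.* ℕtoℚ b)      ≡⟨ cong (e ℚ.*_) (ℕtoℚ-homo-* (p ^ v) b) ⟨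
    e ℚ.* ℕtoℚ (p ^ v * b)               ≡⟨ eq ⟩
    ℕtoℚ (M * X)                          ≡⟨ cong ℕtoℚ M*X≡ ⟩
    ℕtoℚ (p ^ v * (p ^ k * (d * X)))      ≡⟨ ℕtoℚ-homo-* (p ^ v) (p ^ k * (d * X)) ⟩
    ℕtoℚ (p ^ v) ℚ.* ℕtoℚ (p ^ k * (d * X))
      ≡⟨ cong (λ z → ℕtoℚ (p ^ v) ℚ.* ℤtoℚ z) (ℤP.pos-* (p ^ k) (d * X)) ⟩
    ℕtoℚ (p ^ v) ℚ.* ℤtoℚ (+ (p ^ k) ℤ.* + (d * X))
      ∎)
  where
  open ≡-Reasoning
  reassociate : ∀ a b d X → a * b * d * X ≡ b * (a * (d * X))
  reassociate = ℕ-Solver.solve-∀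
  M*X≡ : M * X ≡ p ^ v * (p ^ k * (d * X))
  M*X≡ = trans (cong (λ m → m * X) (trans M≡ (cong (_* d) (ℕP.^-distribˡ-+-* p k v))))
               (reassociate (p ^ k) (p ^ v) d X)

mainTheorem3 : (p : ℕ) (pr : Prime p) (n : ℕ) → 1 ≤ n →
    VolkenbornIntegralIs p pr (λ x → ℤtoℚ (+ rising x n)) (rhs n)
mainTheorem3 p pr (suc n) _ k
  with p-power-decomposition (ℕ.nonTrivial⇒n>1 p {{prime⇒nonTrivial pr}}) (suc (suc n)) ℕ.z<s
... | v , b , n+1≡p^v*b , p∤b = k + v , λ N k+v≤N → converges N (ℕP.m≤n⇒∃[o]m+o≡n k+v≤N)
  where
  instance
    p≢0 : NonZero p
    p≢0 = prime⇒nonZero pr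
  converges : ∀ N → ∃ (λ r → k + v + r ≡ N) →
    pAdicValAtLeast p k (volkenbornSum p pr (λ x → ℕtoℚ (rising x (suc n))) N ℚ.- rhs (suc n))
  converges N (r , k+v+r≡N) with riemannSum-rising-error n (p ^ N) {{ℕP.m^n≢0 p N}}
  ... | X , error≡ = pAdicValAtLeast-cancel-p^v {k = k} {v} {b} error p∤b
        (trans (cong (p ^_) (sym k+v+r≡N)) (ℕP.^-distribˡ-+-* p (k + v) r))
        (subst (λ c → error ℚ.* ℕtoℚ c ≡ ℕtoℚ (p ^ N * X)) n+1≡p^v*b error≡)
    where
    error : ℚ
    error = volkenbornSum p pr (λ x → ℕtoℚ (rising x (suc n))) N ℚ.- rhs (suc n)
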